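{- Let $\Gamma$ be a simplicial complex on $n$ vertices of dimension $d$, and let $f_j$ denote the number of $j$-dimensional faces of $\Gamma$. Then for each integer $i$ with $1\le i\le n$, $$(n-i)!\,f_{i-1}=[m_{(i,1^{n-i})}]\bigl(\Psi_{\zeta_i}(\Gamma)-\Psi_{\zeta_{i-1}}(\Gamma)\bigr),$$ where $[m_\lambda]g$ denotes the coefficient of the monomial symmetric function $m_\lambda$ in the expansion of the symmetric function $g$ in the monomial basis, and $\Psi_{\zeta_0}(\Gamma)$ is defined to be $1$.
   Context: A face $X$ of a simplicial complex has dimension $|X|-1$; $V(\Gamma)$ is the vertex set and $\Gamma_T=\{X\cap T:X\in\Gamma\}$ for $T\subseteq V(\Gamma)$. For $s\ge1$, $\zeta_s(\Gamma)=1$ if $\dim\Gamma<s$ and $0$ otherwise. For $\Gamma$ on $n$ vertices, $\Psi_{\zeta_s}(\Gamma)=\sum_{\alpha\vDash n}c_\alpha M_\alpha$, where $M_\alpha$ is the monomial quasi-symmetric function and $c_\alpha$, for $\alpha=(\alpha_1,\dots,\alpha_k)$, is the number of ordered set partitions $(V_1,\dots,V_k)$ of $V(\Gamma)$ with $|V_j|=\alpha_j$ and $\dim\Gamma_{V_j}<s$ for all $j$. This is a symmetric function; $m_\lambda=\sum M_\alpha$ over compositions $\alpha$ rearranging to the partition $\lambda$, and $(i,1^{n-i})$ denotes the partition with one part $i$ and $n-i$ parts equal to $1$. -}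

module Defs where

open import Data.Bool using (Bool; true; false; _∧_; _∨_; not; if_then_else_)
open import Data.Nat using (ℕ; zero; suc; _<ᵇ_; _≡ᵇ_; _∸_)
open import Data.Integer using (ℤ; +_; _-_)
open import Data.Fin using (Fin)
open import Data.Fin.Subset using (Subset; _⊆_; _∩_; ∣_∣; ⁅_⁆)
open import Data.Vec using (Vec; []; _∷_; lookup; toList)
open import Data.List using (List; []; _∷_; [_]; map; _++_; concatMap; filterᵇ; length; replicate; allFin)
open import Relation.Binary.PropositionalEquality using (_≡_)

-- A simplicial complex on the vertex set Fin n (so V(Γ) = Fin n: every
-- singleton is a face), given by a decidable (Bool-valued) face predicate,
-- closed under taking subsets.
record SimplicialComplex (n : ℕ) : Set where
  field
    isFace   : Subset n → Bool
    closed   : ∀ {X Y : Subset n} → Y ⊆ X → isFace X ≡ true → isFace Y ≡ true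
    vertices : ∀ (v : Fin n) → isFace ⁅ v ⁆ ≡ true

open SimplicialComplex public

allᵇ : ∀ {A : Set} → (A → Bool) → List A → Bool
allᵇ p []       = true
allᵇ p (x ∷ xs) = p x ∧ allᵇ p xs

allSubsets : (n : ℕ) → List (Subset n)
allSubsets zero    = [ [] ]
allSubsets (suc n) = map (true ∷_) (allSubsets n) ++ map (false ∷_) (allSubsets n)

allTuples : (n k : ℕ) → List (Vec (Subset n) k)
allTuples n zero    = [ [] ]
allTuples n (suc k) = concatMap (λ X → map (X ∷_) (allTuples n k)) (allSubsets n)

fVec : ∀ {n} → SimplicialComplex n → ℕ → ℕ
fVec {n} Γ j = length (filterᵇ (λ X → isFace Γ X ∧ (∣ X ∣ ≡ᵇ suc j)) (allSubsets n))

-- dim Γ_T < s.  The faces of Γ_T are the sets X ∩ T (X ∈ Γ), of dimension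
-- ∣X ∩ T∣ - 1; dim Γ_T < s iff every such face has ∣X ∩ T∣ - 1 < s,
-- i.e. ∣X ∩ T∣ < s + 1.
dimRestrictLT : ∀ {n} → SimplicialComplex n → Subset n → ℕ → Bool
dimRestrictLT {n} Γ T s = allᵇ (λ X → not (isFace Γ X) ∨ (∣ X ∩ T ∣ <ᵇ suc s)) (allSubsets n)

-- (V_1,…,V_k) is an ordered set partition of Fin n: every vertex lies in
-- exactly one block (block sizes are checked separately).
coversOnce : ∀ {n k} → Vec (Subset n) k → Bool
coversOnce {n} Vs = allᵇ (λ v → length (filterᵇ (λ B → lookup B v) (toList Vs)) ≡ᵇ 1) (allFin n)

sizesAre : ∀ {n k} → Vec (Subset n) k → List ℕ → Bool
sizesAre []       []       = true
sizesAre (B ∷ Bs) (a ∷ as) = (∣ B ∣ ≡ᵇ a) ∧ sizesAre Bs as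
sizesAre _        _        = false

allBlocks : ∀ {n k} → (Subset n → Bool) → Vec (Subset n) k → Bool
allBlocks p []       = true
allBlocks p (B ∷ Bs) = p B ∧ allBlocks p Bs

-- Quasi-symmetric functions (with integer coefficients), represented by
-- their coefficient function in the monomial basis: α ↦ [M_α] g.
QSym : Set
QSym = List ℕ → ℤ

_-Q_ : QSym → QSym → QSym
(f -Q g) α = f α - g α

oneQ : QSym
oneQ []      = + 1
oneQ (_ ∷ _) = + 0

-- Ψ_{ζ_s}(Γ) = Σ_α c_α M_α, where c_α counts ordered set partitions
-- (V_1,…,V_k) of V(Γ) with |V_j| = α_j and dim Γ_{V_j} < s for all j;
-- Ψ_{ζ_0}(Γ) := 1.
Ψζ : ∀ {n} → SimplicialComplex n → ℕ → QSym
Ψζ Γ zero α = oneQ α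
Ψζ {n} Γ (suc s) α =
  + length (filterᵇ (λ Vs → coversOnce Vs ∧ sizesAre Vs α ∧ allBlocks (λ B → dimRestrictLT Γ B (suc s)) Vs)
                    (allTuples n (length α)))

-- Partitions written as weakly decreasing lists of positive parts.
-- For a symmetric function g = Σ_λ a_λ m_λ, the coefficient [m_λ] g equals
-- the coefficient of M_λ (λ read as a composition).
[m_]_ : List ℕ → QSym → ℤ
[m_]_ λ′ g = g λ′

hook : ℕ → ℕ → List ℕ
hook n i = i ∷ replicate (n ∸ i) 1

-- Splitting off the first block, an ordered set partition of type (i, 1^(n-i))
-- is an i-set T followed by one of the (n-i)! orderings of its complement into
-- singletons.  Singletons have dimension 0 < s, so for s ≥ 1 the coefficient of
-- m_(i,1^(n-i)) in Ψ_ζs(Γ) is (n-i)! times the number of i-sets T with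
-- dim Γ_T < s; for s = 0 both vanish, as every vertex is a face.  An i-set T
-- always has dim Γ_T < i, and dim Γ_T < i-1 exactly when T is not a face, so
-- the difference of the two coefficients counts the (i-1)-faces.
module Submission where

open import Defs
open import Data.Nat using (ℕ; _≤_; _∸_; _*_)
open import Data.Nat.Base using (_!)
open import Data.Integer using (+_)
open import Relation.Binary.PropositionalEquality using (_≡_)

open import Data.Nat.Base using (zero; suc; _+_; _<_; _≡ᵇ_; _<ᵇ_; s≤s; z≤n; z<s)
open import Data.Nat.Properties
  using (≤-refl; ≤-trans; ≤-reflexive; ≤∧≢⇒<; ≤⇒≯; >⇒≢; <⇒≢; +-suc; *-suc; *-zeroʳ; *-comm;
         *-distribˡ-+; suc-injective; ≡ᵇ⇒≡; m≤m+n; m+n∸m≡n)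
open import Data.Integer using (_-_; _⊖_)
open import Data.Integer.Properties using ([+m]-[+n]≡m⊖n; ≤-⊖)
open import Data.Bool.Base using (Bool; true; false; _∧_; _∨_; not; if_then_else_; T)
open import Data.Bool.Properties using (∧-zeroʳ; ∧-identityʳ; ∧-comm; ∧-conicalˡ; ∧-conicalʳ; ∨-zeroʳ; ¬-not; T-≡)
open import Data.List.Base using (List; []; _∷_; map; _++_; concatMap; filterᵇ; length; replicate; allFin)
open import Data.List.Properties using (length-++; filter-++; filter-≐; filter-none)
open import Data.List.Relation.Unary.All using (universal)
import Data.List.Relation.Unary.Any as Any
import Data.List.Membership.Propositional as List
open import Data.List.Membership.Propositional.Properties using (∈-allFin; ∈-++⁺ˡ; ∈-++⁺ʳ; ∈-map⁺)
open import Data.Vec.Base using (Vec; []; _∷_; lookup; toList; here; there)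
open import Data.Vec.Properties using (lookup-map; []=⇒lookup; lookup⇒[]=)
import Data.Fin.Base as Fin
open import Data.Fin.Subset using (Subset; _∈_; _⊆_; _∩_; _─_; ∁; ∣_∣; ⁅_⁆; Nonempty)
open import Data.Fin.Subset.Properties
  using (_⊆?_; drop-∷-⊆; nonempty?; Empty-unique; ∣⊥∣≡0; x∈⁅x⁆; x∈p∩q⁺; x∈p⇒∣p-x∣<∣p∣;
         ∩-idem; ∣p∩q∣≤∣q∣; ∣∁p∣≡n∸∣p∣)
open import Data.Product.Base using (_,_)
open import Function.Base using (_∘_)
open import Function.Bundles using (Equivalence)
open import Relation.Nullary using (yes; no; does; contradiction; T?)
open import Relation.Binary.PropositionalEquality using (_≢_; refl; sym; trans; cong; cong₂; subst; module ≡-Reasoning)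
open ≡-Reasoning

private
  variable
    A A′ : Set
    n k : ℕ

≡ᵇ-true⇒≡ : ∀ {m n} → (m ≡ᵇ n) ≡ true → m ≡ n
≡ᵇ-true⇒≡ e = ≡ᵇ⇒≡ _ _ (Equivalence.from T-≡ e)

<⇒<ᵇ≡true : ∀ {m n} → m < n → (m <ᵇ n) ≡ true
<⇒<ᵇ≡true (s≤s z≤n)       = refl
<⇒<ᵇ≡true (s≤s (s≤s m<n)) = <⇒<ᵇ≡true (s≤s m<n)

≥⇒<ᵇ≡false : ∀ {m n} → n ≤ m → (m <ᵇ n) ≡ false
≥⇒<ᵇ≡false z≤n       = refl
≥⇒<ᵇ≡false (s≤s n≤m) = ≥⇒<ᵇ≡false n≤m

≡ᵇ-∧-cong : ∀ {m n} {x y : Bool} → (m ≡ n → x ≡ y) → (m ≡ᵇ n) ∧ x ≡ (m ≡ᵇ n) ∧ y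
≡ᵇ-∧-cong {m} {n} h with m ≡ᵇ n in e
... | false = refl
... | true  = h (≡ᵇ-true⇒≡ e)

count : (A → Bool) → List A → ℕ
count p xs = length (filterᵇ p xs)

count-∷ : ∀ (p : A → Bool) x xs → count p (x ∷ xs) ≡ (if p x then suc (count p xs) else count p xs)
count-∷ p x xs with p x
... | true  = refl
... | false = refl

count-++ : ∀ (p : A → Bool) xs ys → count p (xs ++ ys) ≡ count p xs + count p ys
count-++ p xs ys = trans (cong length (filter-++ (T? ∘ p) xs ys)) (length-++ (filterᵇ p xs))

count-map : ∀ (p : A′ → Bool) (f : A → A′) xs → count p (map f xs) ≡ count (p ∘ f) xs
count-map p f []       = refl
count-map p f (x ∷ xs) with p (f x)
... | true  = cong suc (count-map p f xs)
... | false = count-map p f xs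

count-cong : ∀ {p q : A → Bool} → (∀ x → p x ≡ q x) → ∀ xs → count p xs ≡ count q xs
count-cong {p = p} {q} p≗q xs =
  cong length (filter-≐ (T? ∘ p) (T? ∘ q) ((λ {x} → subst T (p≗q x)) , (λ {x} → subst T (sym (p≗q x)))) xs)

count-none : ∀ {p : A → Bool} → (∀ x → p x ≡ false) → ∀ xs → count p xs ≡ 0
count-none {p = p} none xs = cong length (filter-none (T? ∘ p) (universal (λ x → subst T (none x)) xs))

count-concatMap : ∀ {p : A′ → Bool} (f : A → List A′) (q : A → Bool) {c : ℕ} →
  (∀ x → count p (f x) ≡ (if q x then c else 0)) →
  ∀ xs → count p (concatMap f xs) ≡ c * count q xs
count-concatMap         f q {c} h []       = sym (*-zeroʳ c)
count-concatMap {p = p} f q {c} h (x ∷ xs) = begin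
  count p (f x ++ concatMap f xs)                     ≡⟨ count-++ p (f x) (concatMap f xs) ⟩
  count p (f x) + count p (concatMap f xs)            ≡⟨ cong₂ _+_ (h x) (count-concatMap f q h xs) ⟩
  (if q x then c else 0) + c * count q xs             ≡⟨ split (q x) ⟩
  c * (if q x then suc (count q xs) else count q xs)  ≡⟨ cong (c *_) (count-∷ q x xs) ⟨
  c * count q (x ∷ xs)                                ∎
  where
  split : ∀ b → (if b then c else 0) + c * count q xs ≡ c * (if b then suc (count q xs) else count q xs)
  split true  = sym (*-suc c (count q xs))
  split false = refl

count-partition : ∀ (p q : A → Bool) xs →
  count p xs ≡ count (λ x → p x ∧ not (q x)) xs + count (λ x → p x ∧ q x) xs
count-partition p q []       = refl
count-partition p q (x ∷ xs)
  rewrite count-∷ p x xs | count-∷ (λ y → p y ∧ not (q y)) x xs | count-∷ (λ y → p y ∧ q y) x xs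
  with p x | q x
... | true  | true  = trans (cong suc (count-partition p q xs)) (sym (+-suc _ _))
... | true  | false = cong suc (count-partition p q xs)
... | false | _     = count-partition p q xs

allᵇ-cong : ∀ {p q : A → Bool} → (∀ x → p x ≡ q x) → ∀ xs → allᵇ p xs ≡ allᵇ q xs
allᵇ-cong p≗q []       = refl
allᵇ-cong p≗q (x ∷ xs) = cong₂ _∧_ (p≗q x) (allᵇ-cong p≗q xs)

allᵇ-true⁺ : ∀ {p : A → Bool} → (∀ x → p x ≡ true) → ∀ xs → allᵇ p xs ≡ true
allᵇ-true⁺ all []       = refl
allᵇ-true⁺ all (x ∷ xs) = cong₂ _∧_ (all x) (allᵇ-true⁺ all xs)

allᵇ-true⁻ : ∀ {p : A → Bool} {x xs} → allᵇ p xs ≡ true → x List.∈ xs → p x ≡ true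
allᵇ-true⁻ {p = p} {xs = y ∷ ys} h (Any.here refl) = ∧-conicalˡ (p y) (allᵇ p ys) h
allᵇ-true⁻ {p = p} {xs = y ∷ ys} h (Any.there x∈ys) = allᵇ-true⁻ (∧-conicalʳ (p y) (allᵇ p ys) h) x∈ys

allᵇ-false⁺ : ∀ {p : A → Bool} {x xs} → x List.∈ xs → p x ≡ false → allᵇ p xs ≡ false
allᵇ-false⁺ {p = p} {xs = y ∷ ys} (Any.here refl) px = cong (_∧ allᵇ p ys) px
allᵇ-false⁺ {p = p} {xs = y ∷ ys} (Any.there x∈ys) px =
  trans (cong (p y ∧_) (allᵇ-false⁺ x∈ys px)) (∧-zeroʳ (p y))

∈-allSubsets : ∀ (X : Subset n) → X List.∈ allSubsets n
∈-allSubsets []                = Any.here refl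
∈-allSubsets {suc n} (true ∷ X)  = ∈-++⁺ˡ (∈-map⁺ (true ∷_) (∈-allSubsets X))
∈-allSubsets {suc n} (false ∷ X) = ∈-++⁺ʳ (map (true ∷_) (allSubsets n)) (∈-map⁺ (false ∷_) (∈-allSubsets X))

x∈p⇒0<∣p∣ : ∀ {x} {p : Subset n} → x ∈ p → 0 < ∣ p ∣
x∈p⇒0<∣p∣ x∈p = ≤-trans (s≤s z≤n) (x∈p⇒∣p-x∣<∣p∣ x∈p)

0<∣p∣⇒Nonempty : ∀ {p : Subset n} → 0 < ∣ p ∣ → Nonempty p
0<∣p∣⇒Nonempty {n} {p} 0<∣p∣ with nonempty? p
... | yes ne   = ne
... | no empty = contradiction (trans (cong ∣_∣ (Empty-unique empty)) (∣⊥∣≡0 n)) (>⇒≢ 0<∣p∣)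

∣p∩q∣≡∣q∣⇒q⊆p : ∀ (p q : Subset n) → ∣ p ∩ q ∣ ≡ ∣ q ∣ → q ⊆ p
∣p∩q∣≡∣q∣⇒q⊆p (true  ∷ p) (true  ∷ q) e here        = here
∣p∩q∣≡∣q∣⇒q⊆p (true  ∷ p) (true  ∷ q) e (there x∈q) = there (∣p∩q∣≡∣q∣⇒q⊆p p q (suc-injective e) x∈q)
∣p∩q∣≡∣q∣⇒q⊆p (false ∷ p) (true  ∷ q) e x∈q         = contradiction e (<⇒≢ (s≤s (∣p∩q∣≤∣q∣ p q)))
∣p∩q∣≡∣q∣⇒q⊆p (true  ∷ p) (false ∷ q) e (there x∈q) = there (∣p∩q∣≡∣q∣⇒q⊆p p q e x∈q)
∣p∩q∣≡∣q∣⇒q⊆p (false ∷ p) (false ∷ q) e (there x∈q) = there (∣p∩q∣≡∣q∣⇒q⊆p p q e x∈q)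

p⊆q⇒∣p∣+∣q─p∣≡∣q∣ : ∀ {p q : Subset n} → p ⊆ q → ∣ p ∣ + ∣ q ─ p ∣ ≡ ∣ q ∣
p⊆q⇒∣p∣+∣q─p∣≡∣q∣ {p = []}        {[]}        p⊆q = refl
p⊆q⇒∣p∣+∣q─p∣≡∣q∣ {p = true ∷ p}  {true ∷ q}  p⊆q = cong suc (p⊆q⇒∣p∣+∣q─p∣≡∣q∣ (drop-∷-⊆ p⊆q))
p⊆q⇒∣p∣+∣q─p∣≡∣q∣ {p = true ∷ p}  {false ∷ q} p⊆q = contradiction (p⊆q here) λ ()
p⊆q⇒∣p∣+∣q─p∣≡∣q∣ {p = false ∷ p} {true ∷ q}  p⊆q =
  trans (+-suc ∣ p ∣ ∣ q ─ p ∣) (cong suc (p⊆q⇒∣p∣+∣q─p∣≡∣q∣ (drop-∷-⊆ p⊆q)))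
p⊆q⇒∣p∣+∣q─p∣≡∣q∣ {p = false ∷ p} {false ∷ q} p⊆q = p⊆q⇒∣p∣+∣q─p∣≡∣q∣ (drop-∷-⊆ p⊆q)

lookup-─ : ∀ (p q : Subset n) v → lookup (p ─ q) v ≡ (if lookup q v then false else lookup p v)
lookup-─ (x ∷ p) (true  ∷ q) Fin.zero    = refl
lookup-─ (x ∷ p) (false ∷ q) Fin.zero    = refl
lookup-─ (x ∷ p) (y     ∷ q) (Fin.suc v) = lookup-─ p q v

count-empty⊆ : ∀ (C : Subset n) → count (λ B → does (B ⊆? C) ∧ (∣ B ∣ ≡ᵇ 0)) (allSubsets n) ≡ 1
count-empty⊆ []               = refl
count-empty⊆ {suc n} (c ∷ C) = begin
  count p (map (true ∷_) (allSubsets n) ++ map (false ∷_) (allSubsets n))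
    ≡⟨ count-++ p (map (true ∷_) (allSubsets n)) _ ⟩
  count p (map (true ∷_) (allSubsets n)) + count p (map (false ∷_) (allSubsets n))
    ≡⟨ cong₂ _+_ (trans (count-map p (true ∷_) (allSubsets n)) (count-none (λ B → ∧-zeroʳ _) (allSubsets n)))
                 (trans (count-map p (false ∷_) (allSubsets n)) (count-empty⊆ C)) ⟩
  1 ∎
  where
  p : Subset (suc n) → Bool
  p B = does (B ⊆? (c ∷ C)) ∧ (∣ B ∣ ≡ᵇ 0)

count-singletons⊆ : ∀ (C : Subset n) → count (λ B → does (B ⊆? C) ∧ (∣ B ∣ ≡ᵇ 1)) (allSubsets n) ≡ ∣ C ∣
count-singletons⊆ []               = refl
count-singletons⊆ {suc n} (c ∷ C) = begin
  count p (map (true ∷_) (allSubsets n) ++ map (false ∷_) (allSubsets n))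
    ≡⟨ count-++ p (map (true ∷_) (allSubsets n)) _ ⟩
  count p (map (true ∷_) (allSubsets n)) + count p (map (false ∷_) (allSubsets n))
    ≡⟨ cong₂ _+_ (trans (count-map p (true ∷_) (allSubsets n)) (headSingletons c))
                 (trans (count-map p (false ∷_) (allSubsets n)) (count-singletons⊆ C)) ⟩
  (if c then 1 else 0) + ∣ C ∣
    ≡⟨ size-∷ c ⟩
  ∣ c ∷ C ∣ ∎
  where
  p : Subset (suc n) → Bool
  p B = does (B ⊆? (c ∷ C)) ∧ (∣ B ∣ ≡ᵇ 1)
  headSingletons : ∀ c → count (λ B → does ((true ∷ B) ⊆? (c ∷ C)) ∧ (∣ B ∣ ≡ᵇ 0)) (allSubsets n)
                         ≡ (if c then 1 else 0)
  headSingletons true  = count-empty⊆ C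
  headSingletons false = count-none (λ B → refl) (allSubsets n)
  size-∷ : ∀ c → (if c then 1 else 0) + ∣ C ∣ ≡ ∣ c ∷ C ∣
  size-∷ true  = refl
  size-∷ false = refl

-- coversOnce Vs is coversExactly Vs ⊤; relative to an arbitrary C, blocks can be peeled off one at a time.
coversExactly : Vec (Subset n) k → Subset n → Bool
coversExactly {n} Bs C =
  allᵇ (λ v → count (λ B → lookup B v) (toList Bs) ≡ᵇ (if lookup C v then 1 else 0)) (allFin n)

coversOnce-∷ : ∀ (X : Subset n) (Bs : Vec (Subset n) k) → coversOnce (X ∷ Bs) ≡ coversExactly Bs (∁ X)
coversOnce-∷ {n} X Bs = allᵇ-cong atVertex (allFin n)
  where
  atVertex : ∀ v → (count (λ B → lookup B v) (X ∷ toList Bs) ≡ᵇ 1)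
                 ≡ (count (λ B → lookup B v) (toList Bs) ≡ᵇ (if lookup (∁ X) v then 1 else 0))
  atVertex v rewrite count-∷ (λ B → lookup B v) X (toList Bs) | lookup-map v not X with lookup X v
  ... | true  = refl
  ... | false = refl

coversExactly-∷ : ∀ {B C : Subset n} {Bs : Vec (Subset n) k} → B ⊆ C →
  coversExactly (B ∷ Bs) C ≡ coversExactly Bs (C ─ B)
coversExactly-∷ {n} {B = B} {C} {Bs} B⊆C = allᵇ-cong atVertex (allFin n)
  where
  atVertex : ∀ v → (count (λ B′ → lookup B′ v) (B ∷ toList Bs) ≡ᵇ (if lookup C v then 1 else 0))
                 ≡ (count (λ B′ → lookup B′ v) (toList Bs) ≡ᵇ (if lookup (C ─ B) v then 1 else 0))
  atVertex v rewrite count-∷ (λ B′ → lookup B′ v) B (toList Bs) | lookup-─ C B v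
    with lookup B v in v∈B | lookup C v in v∈C
  ... | true  | true  = refl
  ... | true  | false = contradiction (trans (sym ([]=⇒lookup (B⊆C (lookup⇒[]= v B v∈B)))) v∈C) λ ()
  ... | false | _     = refl

coversExactly-∷⇒⊆ : ∀ {B C : Subset n} {Bs : Vec (Subset n) k} → coversExactly (B ∷ Bs) C ≡ true → B ⊆ C
coversExactly-∷⇒⊆ {B = B} {C} {Bs} covers {v} v∈B =
  lookup⇒[]= v C (atVertex (allᵇ-true⁻ covers (∈-allFin v)))
  where
  atVertex : (count (λ B′ → lookup B′ v) (B ∷ toList Bs) ≡ᵇ (if lookup C v then 1 else 0)) ≡ true →
             lookup C v ≡ true
  atVertex rewrite count-∷ (λ B′ → lookup B′ v) B (toList Bs) | []=⇒lookup v∈B with lookup C v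
  ... | true  = λ _ → refl
  ... | false = λ ()

coversExactly-[] : ∀ {C : Subset n} → ∣ C ∣ ≡ 0 → coversExactly [] C ≡ true
coversExactly-[] {n} {C} ∣C∣≡0 = allᵇ-true⁺ atVertex (allFin n)
  where
  atVertex : ∀ v → (0 ≡ᵇ (if lookup C v then 1 else 0)) ≡ true
  atVertex v with lookup C v in v∈C
  ... | true  = contradiction (x∈p⇒0<∣p∣ (lookup⇒[]= v C v∈C)) (≤⇒≯ (≤-reflexive ∣C∣≡0))
  ... | false = refl

count-allTuples-suc : ∀ (p : Vec (Subset n) (suc k) → Bool) (q : Subset n → Bool) {c : ℕ} →
  (∀ B → count (p ∘ (B ∷_)) (allTuples n k) ≡ (if q B then c else 0)) →
  count p (allTuples n (suc k)) ≡ c * count q (allSubsets n)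
count-allTuples-suc {n} {k} p q {c} h = count-concatMap (λ B → map (B ∷_) Ts) q firstBlock (allSubsets n)
  where
  Ts : List (Vec (Subset n) k)
  Ts = allTuples n k
  firstBlock : ∀ B → count p (map (B ∷_) Ts) ≡ (if q B then c else 0)
  firstBlock B = trans (count-map p (B ∷_) Ts) (h B)

count-singletonCovers : ∀ m {C : Subset n} → ∣ C ∣ ≡ m →
  count (λ Bs → coversExactly Bs C ∧ sizesAre Bs (replicate m 1)) (allTuples n (length (replicate m 1))) ≡ m !
count-singletonCovers zero {C} ∣C∣≡0 = begin
  count p ([] ∷ [])                    ≡⟨ count-∷ p [] [] ⟩
  (if p [] then 1 else 0)              ≡⟨ cong (λ b → if b then 1 else 0) (trans (∧-identityʳ _) (coversExactly-[] {C = C} ∣C∣≡0)) ⟩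
  1                                    ∎
  where
  p : Vec (Subset _) 0 → Bool
  p Bs = coversExactly Bs C ∧ sizesAre Bs []
count-singletonCovers {n} (suc m) {C} ∣C∣≡1+m = begin
  count (λ Bs → coversExactly Bs C ∧ sizesAre Bs (replicate (suc m) 1)) (allTuples n (suc (length (replicate m 1))))
    ≡⟨ count-allTuples-suc _ (λ B → does (B ⊆? C) ∧ (∣ B ∣ ≡ᵇ 1)) firstBlock ⟩
  m ! * count (λ B → does (B ⊆? C) ∧ (∣ B ∣ ≡ᵇ 1)) (allSubsets n)
    ≡⟨ cong (m ! *_) (trans (count-singletons⊆ C) ∣C∣≡1+m) ⟩
  m ! * suc m
    ≡⟨ *-comm (m !) (suc m) ⟩
  suc m ! ∎
  where
  Ts : List (Vec (Subset n) (length (replicate m 1)))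
  Ts = allTuples n (length (replicate m 1))
  firstBlock : ∀ B → count (λ Bs → coversExactly (B ∷ Bs) C ∧ ((∣ B ∣ ≡ᵇ 1) ∧ sizesAre Bs (replicate m 1))) Ts
                     ≡ (if does (B ⊆? C) ∧ (∣ B ∣ ≡ᵇ 1) then m ! else 0)
  firstBlock B with B ⊆? C
  ... | no B⊈C = count-none (λ Bs → cong (_∧ _) (¬-not (B⊈C ∘ coversExactly-∷⇒⊆))) Ts
  ... | yes B⊆C with ∣ B ∣ ≡ᵇ 1 in ∣B∣≡1
  ...   | false = count-none (λ Bs → ∧-zeroʳ _) Ts
  ...   | true  = trans (count-cong (λ Bs → cong (_∧ _) (coversExactly-∷ B⊆C)) Ts)
                        (count-singletonCovers m {C ─ B} ∣C─B∣≡m)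
    where
    ∣C─B∣≡m : ∣ C ─ B ∣ ≡ m
    ∣C─B∣≡m = suc-injective (begin
      suc ∣ C ─ B ∣         ≡⟨ cong (_+ ∣ C ─ B ∣) (≡ᵇ-true⇒≡ ∣B∣≡1) ⟨
      ∣ B ∣ + ∣ C ─ B ∣     ≡⟨ p⊆q⇒∣p∣+∣q─p∣≡∣q∣ B⊆C ⟩
      ∣ C ∣                 ≡⟨ ∣C∣≡1+m ⟩
      suc m                 ∎)

sizesAre-ones-allBlocks : ∀ {Q : Subset n → Bool} → (∀ B → ∣ B ∣ ≡ 1 → Q B ≡ true) →
  ∀ m (Bs : Vec (Subset n) k) → sizesAre Bs (replicate m 1) ∧ allBlocks Q Bs ≡ sizesAre Bs (replicate m 1)
sizesAre-ones-allBlocks hQ zero    []       = refl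
sizesAre-ones-allBlocks hQ (suc m) []       = refl
sizesAre-ones-allBlocks hQ zero    (B ∷ Bs) = refl
sizesAre-ones-allBlocks hQ (suc m) (B ∷ Bs) with ∣ B ∣ ≡ᵇ 1 in ∣B∣≡1
... | false = refl
... | true rewrite hQ B (≡ᵇ-true⇒≡ ∣B∣≡1) = sizesAre-ones-allBlocks hQ m Bs

dimRestrictLT-small : ∀ (Γ : SimplicialComplex n) {T : Subset n} {s} → ∣ T ∣ ≤ s → dimRestrictLT Γ T s ≡ true
dimRestrictLT-small {n} Γ {T} ∣T∣≤s = allᵇ-true⁺ smallTrace (allSubsets n)
  where
  smallTrace : ∀ X → not (isFace Γ X) ∨ (∣ X ∩ T ∣ <ᵇ suc _) ≡ true
  smallTrace X = trans (cong (not (isFace Γ X) ∨_) (<⇒<ᵇ≡true (s≤s (≤-trans (∣p∩q∣≤∣q∣ X T) ∣T∣≤s)))) (∨-zeroʳ _)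

dimRestrictLT-face : ∀ (Γ : SimplicialComplex n) {X : Subset n} {s} → ∣ X ∣ ≡ suc s →
  dimRestrictLT Γ X s ≡ not (isFace Γ X)
dimRestrictLT-face {n} Γ {X} {s} ∣X∣≡1+s with isFace Γ X in X∈Γ
... | true  = allᵇ-false⁺ (∈-allSubsets X) fullTrace
  where
  fullTrace : not (isFace Γ X) ∨ (∣ X ∩ X ∣ <ᵇ suc s) ≡ false
  fullTrace rewrite X∈Γ | ∩-idem X | ∣X∣≡1+s = ≥⇒<ᵇ≡false (≤-refl {suc s})
... | false = allᵇ-true⁺ properTrace (allSubsets n)
  where
  properTrace : ∀ Y → not (isFace Γ Y) ∨ (∣ Y ∩ X ∣ <ᵇ suc s) ≡ true
  properTrace Y with isFace Γ Y in Y∈Γ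
  ... | false = refl
  ... | true  = <⇒<ᵇ≡true (≤∧≢⇒< (subst (∣ Y ∩ X ∣ ≤_) ∣X∣≡1+s (∣p∩q∣≤∣q∣ Y X)) traceProper)
    where
    traceProper : ∣ Y ∩ X ∣ ≢ suc s
    traceProper eq = contradiction (trans (sym X∈Γ) (closed Γ (∣p∩q∣≡∣q∣⇒q⊆p Y X (trans eq (sym ∣X∣≡1+s))) Y∈Γ)) λ ()

dimRestrictLT-zero : ∀ (Γ : SimplicialComplex n) {X : Subset n} → Nonempty X → dimRestrictLT Γ X 0 ≡ false
dimRestrictLT-zero {n} Γ {X} (v , v∈X) = allᵇ-false⁺ (∈-allSubsets ⁅ v ⁆) vertexTrace
  where
  vertexTrace : not (isFace Γ ⁅ v ⁆) ∨ (∣ ⁅ v ⁆ ∩ X ∣ <ᵇ 1) ≡ false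
  vertexTrace rewrite vertices Γ v = ≥⇒<ᵇ≡false (x∈p⇒0<∣p∣ (x∈p∩q⁺ (x∈⁅x⁆ v , v∈X)))

lowDimSubsets : SimplicialComplex n → ℕ → ℕ → ℕ
lowDimSubsets {n} Γ i s = count (λ T → (∣ T ∣ ≡ᵇ i) ∧ dimRestrictLT Γ T s) (allSubsets n)

Ψζ-hook : ∀ (Γ : SimplicialComplex n) s {i} → 0 < i → Ψζ Γ s (hook n i) ≡ + ((n ∸ i) ! * lowDimSubsets Γ i s)
Ψζ-hook {n} Γ zero {i} 0<i = cong +_ (sym (begin
  (n ∸ i) ! * lowDimSubsets Γ i 0   ≡⟨ cong ((n ∸ i) ! *_) (count-none voidRestriction (allSubsets n)) ⟩
  (n ∸ i) ! * 0                     ≡⟨ *-zeroʳ ((n ∸ i) !) ⟩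
  0                                 ∎))
  where
  voidRestriction : ∀ T → (∣ T ∣ ≡ᵇ i) ∧ dimRestrictLT Γ T 0 ≡ false
  voidRestriction T = trans (≡ᵇ-∧-cong λ ∣T∣≡i → dimRestrictLT-zero Γ (0<∣p∣⇒Nonempty (subst (0 <_) (sym ∣T∣≡i) 0<i)))
                            (∧-zeroʳ _)
Ψζ-hook {n} Γ (suc s) {i} _ = cong +_ (count-allTuples-suc _ (λ X → (∣ X ∣ ≡ᵇ i) ∧ Q X) firstBlock)
  where
  Q : Subset n → Bool
  Q B = dimRestrictLT Γ B (suc s)
  Ts : List (Vec (Subset n) (length (replicate (n ∸ i) 1)))
  Ts = allTuples n (length (replicate (n ∸ i) 1))
  firstBlock : ∀ X → count (λ Bs → coversOnce (X ∷ Bs) ∧ ((∣ X ∣ ≡ᵇ i) ∧ sizesAre Bs (replicate (n ∸ i) 1))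
                                                        ∧ (Q X ∧ allBlocks Q Bs)) Ts
                     ≡ (if (∣ X ∣ ≡ᵇ i) ∧ Q X then (n ∸ i) ! else 0)
  firstBlock X with ∣ X ∣ ≡ᵇ i in ∣X∣≡i | Q X
  ... | false | _     = count-none (λ Bs → ∧-zeroʳ _) Ts
  ... | true  | false = count-none (λ Bs → trans (cong (coversOnce (X ∷ Bs) ∧_) (∧-zeroʳ _)) (∧-zeroʳ _)) Ts
  ... | true  | true  = trans (count-cong (λ Bs → cong₂ _∧_ (coversOnce-∷ X Bs) (sizesAre-ones-allBlocks singletonsLow _ Bs)) Ts)
                             (count-singletonCovers (n ∸ i) {∁ X} ∣∁X∣≡n∸i)
    where
    ∣∁X∣≡n∸i : ∣ ∁ X ∣ ≡ n ∸ i
    ∣∁X∣≡n∸i = trans (∣∁p∣≡n∸∣p∣ X) (cong (n ∸_) (≡ᵇ-true⇒≡ {∣ X ∣} ∣X∣≡i))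
    singletonsLow : ∀ B → ∣ B ∣ ≡ 1 → Q B ≡ true
    singletonsLow B ∣B∣≡1 = dimRestrictLT-small Γ (≤-trans (≤-reflexive ∣B∣≡1) (s≤s z≤n))

lowDimSubsets-suc : ∀ (Γ : SimplicialComplex n) k →
  lowDimSubsets Γ (suc k) (suc k) ≡ lowDimSubsets Γ (suc k) k + fVec Γ k
lowDimSubsets-suc {n} Γ k = begin
  lowDimSubsets Γ (suc k) (suc k)
    ≡⟨ count-cong (λ X → trans (≡ᵇ-∧-cong (dimRestrictLT-small Γ ∘ ≤-reflexive)) (∧-identityʳ _)) S ⟩
  count (λ X → ∣ X ∣ ≡ᵇ suc k) S
    ≡⟨ count-partition (λ X → ∣ X ∣ ≡ᵇ suc k) (isFace Γ) S ⟩
  count (λ X → (∣ X ∣ ≡ᵇ suc k) ∧ not (isFace Γ X)) S + count (λ X → (∣ X ∣ ≡ᵇ suc k) ∧ isFace Γ X) S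
    ≡⟨ cong₂ _+_ (count-cong (λ X → ≡ᵇ-∧-cong (sym ∘ dimRestrictLT-face Γ)) S)
                 (count-cong (λ X → ∧-comm (∣ X ∣ ≡ᵇ suc k) (isFace Γ X)) S) ⟩
  lowDimSubsets Γ (suc k) k + fVec Γ k ∎
  where
  S : List (Subset n)
  S = allSubsets n

+[m+n]-+m≡+n : ∀ m n → + (m + n) - + m ≡ + n
+[m+n]-+m≡+n m n = begin
  + (m + n) - + m     ≡⟨ [+m]-[+n]≡m⊖n (m + n) m ⟩
  (m + n) ⊖ m         ≡⟨ ≤-⊖ (m≤m+n m n) ⟩
  + (m + n ∸ m)       ≡⟨ cong +_ (m+n∸m≡n m n) ⟩
  + n                 ∎

proposition4p5 : ∀ {n : ℕ} (Γ : SimplicialComplex n) (i : ℕ) → 1 ≤ i → i ≤ n →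
    + ((n ∸ i) ! * fVec Γ (i ∸ 1)) ≡ [m hook n i ] (Ψζ Γ i -Q Ψζ Γ (i ∸ 1))
proposition4p5 Γ zero () _
proposition4p5 {n} Γ (suc k) _ _ = sym (begin
  Ψζ Γ (suc k) (hook n (suc k)) - Ψζ Γ k (hook n (suc k))
    ≡⟨ cong₂ _-_ (Ψζ-hook Γ (suc k) z<s) (Ψζ-hook Γ k z<s) ⟩
  + (c * lowDimSubsets Γ (suc k) (suc k)) - + (c * nonFaces)
    ≡⟨ cong (λ t → + (c * t) - + (c * nonFaces)) (lowDimSubsets-suc Γ k) ⟩
  + (c * (nonFaces + fVec Γ k)) - + (c * nonFaces)
    ≡⟨ cong (λ t → + t - + (c * nonFaces)) (*-distribˡ-+ c nonFaces (fVec Γ k)) ⟩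
  + (c * nonFaces + c * fVec Γ k) - + (c * nonFaces)
    ≡⟨ +[m+n]-+m≡+n (c * nonFaces) (c * fVec Γ k) ⟩
  + (c * fVec Γ k) ∎)
  where
  c nonFaces : ℕ
  c        = (n ∸ suc k) !
  nonFaces = lowDimSubsets Γ (suc k) k
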